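{- Let $R_1,\dots,R_n$ be representations such that for each $1\le i<n$, $R_{i+1}$ is obtained from $R_i$ by a (possibly empty) sequence of minifying operations. If $R_1$ and $R_n$ are equivalent, then $R_1,\dots,R_n$ are all equivalent.
   Context: A representation $\langle T,\mathcal P\rangle$: a tree $T$ and a family $\mathcal P=(P_v)_{v\in V}$ of simple paths of $T$ with at least one edge. Paths intersect if they share an edge; $\mathrm{split}(P,P')$ is the set of vertices of degree $\ge3$ in $P\cup P'$; $P\sim P'$ means intersecting with empty split set. The EPT graph on $V$ has $uv$ an edge iff $P_u,P_v$ intersect; the ENPT graph has $uv$ an edge iff $P_u\sim P_v$. Two representations (on the same index set $V$) are equivalent if they have the same EPT graph and the same ENPT graph. Minifying operations: contracting an edge of $T$ (and of all paths using it); removing an end edge from a path. -}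

module Defs where

open import Data.Nat using (ℕ; zero; suc; _≤_)
open import Data.Fin using (Fin; _≟_)
open import Data.Bool using (Bool; true)
open import Data.List using (List; []; _∷_; _++_; length; map)
open import Data.List.Relation.Unary.Linked using (Linked)
open import Data.List.Relation.Unary.Unique.Propositional using (Unique)
open import Data.Product using (Σ; ∃; ∃-syntax; _×_; _,_)
open import Data.Sum using (_⊎_)
open import Relation.Nullary using (¬_; yes; no)
open import Relation.Binary.PropositionalEquality using (_≡_; _≢_; subst)
open import Function.Bundles using (_⇔_)

record Tree : Set where
  field
    m         : ℕ
    adj       : Fin m → Fin m → Bool
    nonempty  : 1 ≤ m
    adj-sym   : ∀ x y → adj x y ≡ true → adj y x ≡ true
    adj-irr   : ∀ x → ¬ (adj x x ≡ true)

  Adj : Fin m → Fin m → Set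
  Adj x y = adj x y ≡ true

  field
    connected : ∀ x y → x ≡ y ⊎ ∃[ ws ] Linked Adj (x ∷ ws ++ y ∷ [])
    acyclic   : ∀ x ys → 2 ≤ length ys → Unique (x ∷ ys) →
                ¬ Linked Adj (x ∷ ys ++ x ∷ [])

open Tree public

data Consec {A : Set} : List A → A → A → Set where
  here  : ∀ {x y xs} → Consec (x ∷ y ∷ xs) x y
  there : ∀ {z x y xs} → Consec xs x y → Consec (z ∷ xs) x y

PEdgeL : {A : Set} → List A → A → A → Set
PEdgeL xs x y = Consec xs x y ⊎ Consec xs y x

record TPath (T : Tree) : Set where
  constructor mkPath
  field
    verts  : List (Fin (m T))
    long   : 2 ≤ length verts
    walk   : Linked (Adj T) verts
    simple : Unique verts

open TPath public

module _ {T : Tree} where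

  PEdge : TPath T → Fin (m T) → Fin (m T) → Set
  PEdge P = PEdgeL (verts P)

  Intersect : TPath T → TPath T → Set
  Intersect P Q = ∃[ x ] ∃[ y ] (PEdge P x y × PEdge Q x y)

  UEdge : TPath T → TPath T → Fin (m T) → Fin (m T) → Set
  UEdge P Q x y = PEdge P x y ⊎ PEdge Q x y

  -- v ∈ split(P,Q): v has degree ≥ 3 in P ∪ Q
  InSplit : TPath T → TPath T → Fin (m T) → Set
  InSplit P Q v = ∃[ w₁ ] ∃[ w₂ ] ∃[ w₃ ]
    (w₁ ≢ w₂ × w₁ ≢ w₃ × w₂ ≢ w₃ ×
     UEdge P Q v w₁ × UEdge P Q v w₂ × UEdge P Q v w₃)

  _∼_ : TPath T → TPath T → Set
  P ∼ Q = Intersect P Q × (∀ v → ¬ InSplit P Q v)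

record Rep (V : Set) : Set where
  constructor ⟨_,_⟩
  field
    tree  : Tree
    paths : V → TPath tree

open Rep public

module _ {V : Set} where

  EPT : Rep V → V → V → Set
  EPT R u v = Intersect (paths R u) (paths R v)

  ENPT : Rep V → V → V → Set
  ENPT R u v = paths R u ∼ paths R v

  Equivalent : Rep V → Rep V → Set
  Equivalent R R' = ∀ u v → u ≢ v →
    (EPT R u v ⇔ EPT R' u v) × (ENPT R u v ⇔ ENPT R' u v)

dedupFrom : {k : ℕ} → Fin k → List (Fin k) → List (Fin k)
dedupFrom p [] = []
dedupFrom p (y ∷ xs) with p ≟ y
... | yes _ = dedupFrom p xs
... | no  _ = y ∷ dedupFrom y xs

dedupAdj : {k : ℕ} → List (Fin k) → List (Fin k)
dedupAdj [] = []
dedupAdj (x ∷ xs) = x ∷ dedupFrom x xs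

dropLast : {A : Set} → List A → List A
dropLast [] = []
dropLast (x ∷ []) = []
dropLast (x ∷ y ∷ xs) = x ∷ dropLast (y ∷ xs)

dropFirst : {A : Set} → List A → List A
dropFirst [] = []
dropFirst (_ ∷ xs) = xs

module _ {V : Set} where

  -- R' is obtained from R by contracting an edge ab of the tree
  -- (the vertices of the new tree are named via a quotient map φ which
  -- identifies exactly a and b; every path is mapped along φ).
  Contract : Rep V → Rep V → Set
  Contract R R' =
    let T = tree R ; T' = tree R' in
    ∃[ a ] ∃[ b ] Adj T a b × Σ (Fin (m T) → Fin (m T')) λ φ →
      (∀ u → ∃[ x ] φ x ≡ u) ×
      φ a ≡ φ b ×
      (∀ x y → φ x ≡ φ y → x ≡ y ⊎ (x ≡ a × y ≡ b) ⊎ (x ≡ b × y ≡ a)) ×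
      (∀ u w → Adj T' u w ⇔
         (∃[ x ] ∃[ y ] (φ x ≡ u × φ y ≡ w × Adj T x y ×
            ¬ ((x ≡ a × y ≡ b) ⊎ (x ≡ b × y ≡ a))))) ×
      (∀ v → verts (paths R' v) ≡ dedupAdj (map φ (verts (paths R v))))

  RemoveEnd : Rep V → Rep V → Set
  RemoveEnd R R' =
    Σ (tree R ≡ tree R') λ e →
    let tr : List (Fin (m (tree R))) → List (Fin (m (tree R')))
        tr = subst (λ T → List (Fin (m T))) e in
    ∃[ v₀ ]
      ((verts (paths R' v₀) ≡ tr (dropFirst (verts (paths R v₀)))
        ⊎ verts (paths R' v₀) ≡ tr (dropLast (verts (paths R v₀)))) ×
       (∀ v → v ≢ v₀ → verts (paths R' v) ≡ tr (verts (paths R v))))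

  data Minify (R R' : Rep V) : Set where
    contract  : Contract R R' → Minify R R'
    removeEnd : RemoveEnd R R' → Minify R R'

-- Minifying never creates a shared edge, and never splits a pair of paths that still
-- share an edge: removing an end edge only shrinks paths, and after contracting an edge
-- ab a vertex of degree ≥ 3 in P′ ∪ Q′ lifts to one of P ∪ Q, because the union of two
-- intersecting paths is a subtree and hence contains ab as soon as it contains a and b.
-- So along R₁ →* Rᵢ →* Rₙ EPT edges can only disappear and, while they survive, ENPT
-- edges can only appear; as R₁ and Rₙ are equivalent, neither can happen.
module Submission where

open import Defs
open import Data.Nat using (ℕ; suc; _≤_; _<_; _≤′_; ≤′-reflexive; ≤′-step; s≤s; z≤n)
open import Data.Nat.Properties using (≤-refl; ≤-trans; <⇒≤; ≤⇒≤′; ≤′⇒≤)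
open import Data.Fin using (Fin; _≟_)
open import Data.List using (List; []; _∷_; _++_; map)
open import Data.List.Relation.Unary.Any using (here; there)
open import Data.List.Relation.Unary.All.Properties using (¬Any⇒All¬)
open import Data.List.Relation.Unary.Linked using (Linked; [-]; _∷_)
open import Data.List.Relation.Unary.All using ([]; _∷_)
open import Data.List.Relation.Unary.AllPairs using ([]; _∷_)
open import Data.List.Relation.Unary.Unique.Propositional using (Unique)
open import Data.List.Membership.Propositional using (_∈_)
open import Data.Product as Prod using (Σ; ∃; ∃₂; _×_; _,_; proj₁; proj₂)
open import Data.Sum as Sum using (_⊎_; inj₁; inj₂)
open import Data.Empty using (⊥; ⊥-elim)
open import Relation.Nullary using (¬_; Dec; yes; no)
import Relation.Nullary.Decidable as Dec
open import Relation.Binary.Definitions using (DecidableEquality)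
open import Relation.Binary.PropositionalEquality using (_≡_; _≢_; ≢-sym; refl; sym; trans; cong; subst)
open import Relation.Binary.Construct.Closure.ReflexiveTransitive as Star using (Star; ε; _◅_; _◅◅_)
open import Function using (_∘_; id)
open import Function.Bundles using (Equivalence; _⇔_; mk⇔)
import Function.Properties.Equivalence as ⇔

module _ {A : Set} where

  Consec⇒∈ : ∀ {xs} {x y : A} → Consec xs x y → x ∈ xs × y ∈ xs
  Consec⇒∈ here      = here refl , there (here refl)
  Consec⇒∈ (there c) = Prod.map there there (Consec⇒∈ c)

  PEdgeL⇒∈ : ∀ {xs} {x y : A} → PEdgeL xs x y → x ∈ xs
  PEdgeL⇒∈ (inj₁ c) = proj₁ (Consec⇒∈ c)
  PEdgeL⇒∈ (inj₂ c) = proj₂ (Consec⇒∈ c)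

  Consec⇒Linked : ∀ {R : A → A → Set} {xs x y} → Linked R xs → Consec xs x y → R x y
  Consec⇒Linked (r ∷ _) here      = r
  Consec⇒Linked (_ ∷ l) (there c) = Consec⇒Linked l c

  PEdgeL-there : ∀ {z : A} {xs x y} → PEdgeL xs x y → PEdgeL (z ∷ xs) x y
  PEdgeL-there = Sum.map there there

  walk-to-head : ∀ {h x : A} t → x ∈ h ∷ t → Star (PEdgeL (h ∷ t)) x h
  walk-to-head t       (here refl) = ε
  walk-to-head (y ∷ t) (there x∈)  =
    Star.map PEdgeL-there (walk-to-head t x∈) ◅◅ inj₂ here ◅ ε

  PEdgeL-connected : ∀ {xs} {x y : A} → x ∈ xs → y ∈ xs → Star (PEdgeL xs) x y
  PEdgeL-connected {h ∷ t} x∈ y∈ =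
    walk-to-head t x∈ ◅◅ Star.reverse Sum.swap (walk-to-head t y∈)

  Consec-dropFirst : ∀ xs {x y : A} → Consec (dropFirst xs) x y → Consec xs x y
  Consec-dropFirst (_ ∷ _) c = there c

  Consec-dropLast : ∀ xs {x y : A} → Consec (dropLast xs) x y → Consec xs x y
  Consec-dropLast (_ ∷ _ ∷ [])     (there ())
  Consec-dropLast (_ ∷ _ ∷ _ ∷ _)  here      = here
  Consec-dropLast (_ ∷ y ∷ z ∷ xs) (there c) = there (Consec-dropLast (y ∷ z ∷ xs) c)

  Consec-map⁻ : ∀ {B : Set} (f : A → B) xs {u w} → Consec (map f xs) u w →
                ∃₂ λ x y → Consec xs x y × f x ≡ u × f y ≡ w
  Consec-map⁻ f (x ∷ y ∷ _) here      = x , y , here , refl , refl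
  Consec-map⁻ f (_ ∷ xs)    (there c) with Consec-map⁻ f xs c
  ... | x , y , c′ , fx , fy = x , y , there c′ , fx , fy

module _ {k : ℕ} where

  Consec-dedupFrom⁻ : ∀ (p : Fin k) ys {u w} → Consec (p ∷ dedupFrom p ys) u w →
                      u ≢ w × Consec (p ∷ ys) u w
  Consec-dedupFrom⁻ p []       (there ())
  Consec-dedupFrom⁻ p (y ∷ ys) c with p ≟ y
  Consec-dedupFrom⁻ p (y ∷ ys) c         | yes refl = Prod.map₂ there (Consec-dedupFrom⁻ p ys c)
  Consec-dedupFrom⁻ p (y ∷ ys) here      | no p≢y   = p≢y , here
  Consec-dedupFrom⁻ p (y ∷ ys) (there c) | no _     = Prod.map₂ there (Consec-dedupFrom⁻ y ys c)

  Consec-dedupAdj⁻ : ∀ (ys : List (Fin k)) {u w} → Consec (dedupAdj ys) u w → u ≢ w × Consec ys u w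
  Consec-dedupAdj⁻ (y ∷ ys) = Consec-dedupFrom⁻ y ys

  Consec? : ∀ (xs : List (Fin k)) x y → Dec (Consec xs x y)
  Consec? []           x y = no λ ()
  Consec? (_ ∷ [])     x y = no λ { (there ()) }
  Consec? (z ∷ z′ ∷ xs) x y =
    Dec.map′ Sum.[ head , there ] unstep (((z ≟ x) Dec.×-dec (z′ ≟ y)) Dec.⊎-dec Consec? (z′ ∷ xs) x y)
    where
    head : z ≡ x × z′ ≡ y → Consec (z ∷ z′ ∷ xs) x y
    head (refl , refl) = here
    unstep : Consec (z ∷ z′ ∷ xs) x y → (z ≡ x × z′ ≡ y) ⊎ Consec (z′ ∷ xs) x y
    unstep here      = inj₁ (refl , refl)
    unstep (there c) = inj₂ c

module _ {A : Set} {E : A → A → Set} where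

  visited : ∀ {x y} → Star E x y → List A
  visited ε               = []
  visited (_◅_ {j = y} _ w) = y ∷ visited w

  module LoopErasure (_≟ᴬ_ : DecidableEquality A) where
    open import Data.List.Membership.DecPropositional _≟ᴬ_ using (_∈?_)

    cut-at : ∀ {y a b} (w : Star E y b) → a ∈ y ∷ visited w → Unique (y ∷ visited w) →
             Σ (Star E a b) λ s → Unique (a ∷ visited s)
    cut-at w       (here refl) u       = w , u
    cut-at (_ ◅ w) (there a∈)  (_ ∷ u) = cut-at w a∈ u

    erase : ∀ {a b} → Star E a b → Σ (Star E a b) λ w → Unique (a ∷ visited w)
    erase ε = ε , [] ∷ []
    erase {a} (_◅_ {j = y} e w) with erase w
    ... | w′ , u′ with a ∈? y ∷ visited w′
    ...   | yes a∈ = cut-at w′ a∈ u′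
    ...   | no  a∉ = e ◅ w′ , ¬Any⇒All¬ _ a∉ ∷ u′

module _ (T : Tree) where

  Adj-sym : ∀ {x y} → Adj T x y → Adj T y x
  Adj-sym = adj-sym T _ _

  Adj⇒≢ : ∀ {x y} → Adj T x y → x ≢ y
  Adj⇒≢ xy refl = adj-irr T _ xy

  no-triangle : ∀ {a b c} → Adj T a b → Adj T c a → Adj T c b → ⊥
  no-triangle ab ca cb =
    acyclic T _ (_ ∷ _ ∷ []) (s≤s (s≤s z≤n))
      ((Adj⇒≢ ca ∷ Adj⇒≢ cb ∷ []) ∷ (Adj⇒≢ ab ∷ []) ∷ [] ∷ [])
      (ca ∷ ab ∷ Adj-sym cb ∷ [-])

  PEdge⇒Adj : (P : TPath T) → ∀ {x y} → PEdge P x y → Adj T x y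
  PEdge⇒Adj P (inj₁ c) = Consec⇒Linked (walk P) c
  PEdge⇒Adj P (inj₂ c) = Adj-sym (Consec⇒Linked (walk P) c)

  module _ {E : Fin (m T) → Fin (m T) → Set} (E⇒Adj : ∀ {x y} → E x y → Adj T x y) where

    private
      closed-walk : ∀ {x z c} (w : Star E x z) → Adj T z c → Linked (Adj T) (x ∷ visited w ++ c ∷ [])
      closed-walk ε       zc = zc ∷ [-]
      closed-walk (e ◅ w) zc = E⇒Adj e ∷ closed-walk w zc

    simple-walk-to-neighbour : ∀ {a b} → Adj T a b → (w : Star E a b) → Unique (a ∷ visited w) → E a b
    simple-walk-to-neighbour ab ε           _ = ⊥-elim (Adj⇒≢ ab refl)
    simple-walk-to-neighbour ab (e ◅ ε)     _ = e
    simple-walk-to-neighbour ab w@(_ ◅ _ ◅ _) u =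
      ⊥-elim (acyclic T _ (visited w) (s≤s (s≤s z≤n)) u (closed-walk w (Adj-sym ab)))

  InUnion : TPath T → TPath T → Fin (m T) → Set
  InUnion P Q x = x ∈ verts P ⊎ x ∈ verts Q

  module _ {P Q : TPath T} where

    UEdge⇒Adj : ∀ {x y} → UEdge P Q x y → Adj T x y
    UEdge⇒Adj = Sum.[ PEdge⇒Adj P , PEdge⇒Adj Q ]

    UEdge⇒InUnion : ∀ {x y} → UEdge P Q x y → InUnion P Q x
    UEdge⇒InUnion = Sum.map PEdgeL⇒∈ PEdgeL⇒∈

    UEdge-convex : ∀ {c x y} → c ∈ verts P → c ∈ verts Q →
                   InUnion P Q x → InUnion P Q y → Adj T x y → UEdge P Q x y
    UEdge-convex {c} c∈P c∈Q x∈ y∈ xy =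
      let w , u = erase (walk-to-c x∈ ◅◅ Star.reverse (Sum.map Sum.swap Sum.swap) (walk-to-c y∈))
      in simple-walk-to-neighbour UEdge⇒Adj xy w u
      where
      open LoopErasure _≟_
      walk-to-c : ∀ {x} → InUnion P Q x → Star (UEdge P Q) x c
      walk-to-c (inj₁ x∈P) = Star.map inj₁ (PEdgeL-connected x∈P c∈P)
      walk-to-c (inj₂ x∈Q) = Star.map inj₂ (PEdgeL-connected x∈Q c∈Q)

    InSplit-via-neighbour : ∀ {c p q y₁ y₂} → c ∈ verts P → c ∈ verts Q → Adj T p q →
      UEdge P Q p y₁ → UEdge P Q p y₂ → InUnion P Q q → y₁ ≢ y₂ → y₁ ≢ q → y₂ ≢ q →
      InSplit P Q p
    InSplit-via-neighbour c∈P c∈Q pq e₁ e₂ q∈ y₁≢y₂ y₁≢q y₂≢q =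
      _ , _ , _ , y₁≢y₂ , y₁≢q , y₂≢q , e₁ , e₂ ,
      UEdge-convex c∈P c∈Q (UEdge⇒InUnion e₁) q∈ pq

  Intersect⇒common : ∀ {P Q : TPath T} → Intersect P Q → ∃ λ c → c ∈ verts P × c ∈ verts Q
  Intersect⇒common (c , _ , e , e′) = c , PEdgeL⇒∈ e , PEdgeL⇒∈ e′

module Contraction {V : Set} {R R′ : Rep V} {a b : Fin (m (tree R))} (ab : Adj (tree R) a b)
  (φ : Fin (m (tree R)) → Fin (m (tree R′))) (φa≡φb : φ a ≡ φ b)
  (φ-fibre : ∀ x y → φ x ≡ φ y → x ≡ y ⊎ (x ≡ a × y ≡ b) ⊎ (x ≡ b × y ≡ a))
  (paths-φ : ∀ v → verts (paths R′ v) ≡ dedupAdj (map φ (verts (paths R v))))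
  where

  private
    T = tree R

  Merged : Fin (m T) → Fin (m T) → Set
  Merged x y = (x ≡ a × y ≡ b) ⊎ (x ≡ b × y ≡ a)

  Merged-sym : ∀ {x y} → Merged x y → Merged y x
  Merged-sym = Sum.swap ∘ Sum.map Prod.swap Prod.swap

  Merged⇒Adj : ∀ {x y} → Merged x y → Adj T x y
  Merged⇒Adj (inj₁ (refl , refl)) = ab
  Merged⇒Adj (inj₂ (refl , refl)) = Adj-sym T ab

  Merged-functional : ∀ {x y y′} → Merged x y → Merged x y′ → y ≡ y′
  Merged-functional (inj₁ (_ , refl)) (inj₁ (_ , refl)) = refl
  Merged-functional (inj₂ (_ , refl)) (inj₂ (_ , refl)) = refl
  Merged-functional (inj₁ (refl , _)) (inj₂ (a≡b , _))  = ⊥-elim (Adj⇒≢ T ab a≡b)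
  Merged-functional (inj₂ (refl , _)) (inj₁ (b≡a , _))  = ⊥-elim (Adj⇒≢ T ab (sym b≡a))

  φ-Merged : ∀ {x y} → Merged x y → φ x ≡ φ a
  φ-Merged (inj₁ (refl , _)) = refl
  φ-Merged (inj₂ (refl , _)) = sym φa≡φb

  φ-common-neighbour : ∀ {x x′ y} → Adj T x y → Adj T x′ y → φ x ≡ φ x′ → x ≡ x′
  φ-common-neighbour xy x′y φx≡φx′ with φ-fibre _ _ φx≡φx′
  ... | inj₁ x≡x′ = x≡x′
  ... | inj₂ m    = ⊥-elim (no-triangle T (Merged⇒Adj m) (Adj-sym T xy) (Adj-sym T x′y))

  φ-edge-injective : ∀ {x y x′ y′} → Adj T x y → Adj T x′ y′ →
    φ x ≡ φ x′ → φ y ≡ φ y′ → φ x ≢ φ y → x ≡ x′ × y ≡ y′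
  φ-edge-injective {x} {y} {x′} {y′} xy x′y′ φx φy φx≢φy with φ-fibre x x′ φx | φ-fibre y y′ φy
  ... | inj₁ refl | _         = refl , φ-common-neighbour (Adj-sym T xy) (Adj-sym T x′y′) φy
  ... | inj₂ _    | inj₁ refl = φ-common-neighbour xy x′y′ φx , refl
  ... | inj₂ m    | inj₂ m′   = ⊥-elim (φx≢φy (trans (φ-Merged m) (sym (φ-Merged m′))))

  φ-reflects-≢ : ∀ {x y} → φ x ≢ φ y → x ≢ y
  φ-reflects-≢ φx≢φy x≡y = φx≢φy (cong φ x≡y)

  Lift : (Fin (m T) → Fin (m T) → Set) → Fin (m (tree R′)) → Fin (m (tree R′)) → Set
  Lift E u w = ∃₂ λ x y → E x y × φ x ≡ u × φ y ≡ w

  Consec-lift : ∀ v {u w} → Consec (verts (paths R′ v)) u w →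
                u ≢ w × Lift (Consec (verts (paths R v))) u w
  Consec-lift v c = Prod.map₂ (Consec-map⁻ φ _)
    (Consec-dedupAdj⁻ (map φ _) (subst (λ l → Consec l _ _) (paths-φ v) c))

  PEdge-lift : ∀ v {u w} → PEdge (paths R′ v) u w → u ≢ w × Lift (PEdge (paths R v)) u w
  PEdge-lift v (inj₁ c) with Consec-lift v c
  ... | u≢w , x , y , c′ , φx , φy = u≢w , x , y , inj₁ c′ , φx , φy
  PEdge-lift v (inj₂ c) with Consec-lift v c
  ... | w≢u , x , y , c′ , φx , φy = ≢-sym w≢u , y , x , inj₂ c′ , φy , φx

  UEdge-lift : ∀ u v {z w} → UEdge (paths R′ u) (paths R′ v) z w →
               z ≢ w × Lift (UEdge (paths R u) (paths R v)) z w
  UEdge-lift u v (inj₁ e) with PEdge-lift u e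
  ... | z≢w , x , y , e′ , φx , φy = z≢w , x , y , inj₁ e′ , φx , φy
  UEdge-lift u v (inj₂ e) with PEdge-lift v e
  ... | z≢w , x , y , e′ , φx , φy = z≢w , x , y , inj₂ e′ , φx , φy

  EPT-reflected : ∀ {u v} → EPT R′ u v → EPT R u v
  EPT-reflected {u} {v} (_ , _ , e , e′) with PEdge-lift u e | PEdge-lift v e′
  ... | φx≢φy , x , y , xy , refl , refl | _ , x′ , y′ , x′y′ , φx′ , φy′
    with φ-edge-injective (PEdge⇒Adj T (paths R u) xy) (PEdge⇒Adj T (paths R v) x′y′)
                          (sym φx′) (sym φy′) φx≢φy
  ... | refl , refl = x , y , xy , x′y′

  module _ {u v : V} {c} (c∈P : c ∈ verts (paths R u)) (c∈Q : c ∈ verts (paths R v)) where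

    private
      P = paths R u
      Q = paths R v

    InSplit-at-merged : ∀ {p q z y y′ y″} → Merged p q → φ q ≡ z →
      UEdge P Q p y → UEdge P Q p y′ → UEdge P Q q y″ →
      φ y ≢ φ y′ → z ≢ φ y → z ≢ φ y′ → InSplit P Q p
    InSplit-at-merged m φq e e′ e″ φy≢φy′ z≢φy z≢φy′ =
      InSplit-via-neighbour T {P} {Q} c∈P c∈Q (Merged⇒Adj m) e e′ (UEdge⇒InUnion T {P} {Q} e″)
        (φ-reflects-≢ φy≢φy′) (avoids z≢φy) (avoids z≢φy′)
      where
      avoids : ∀ {y} → _ ≢ φ y → y ≢ _
      avoids z≢φy refl = z≢φy (sym φq)

    InSplit-lift : ∀ {z} → InSplit (paths R′ u) (paths R′ v) z → ∃ (InSplit P Q)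
    InSplit-lift (_ , _ , _ , w₁≢w₂ , w₁≢w₃ , w₂≢w₃ , e₁ , e₂ , e₃)
      with UEdge-lift u v e₁ | UEdge-lift u v e₂ | UEdge-lift u v e₃
    ... | z≢w₁ , x₁ , y₁ , xy₁ , refl , refl | z≢w₂ , x₂ , y₂ , xy₂ , φx₂ , refl
        | z≢w₃ , x₃ , y₃ , xy₃ , φx₃ , refl
      with φ-fibre x₁ x₂ (sym φx₂) | φ-fibre x₁ x₃ (sym φx₃)
    ... | inj₁ refl | inj₁ refl =
      x₁ , y₁ , y₂ , y₃ , φ-reflects-≢ w₁≢w₂ , φ-reflects-≢ w₁≢w₃ , φ-reflects-≢ w₂≢w₃ ,
      xy₁ , xy₂ , xy₃
    ... | inj₁ refl | inj₂ m₃ = x₁ , InSplit-at-merged m₃ φx₃ xy₁ xy₂ xy₃ w₁≢w₂ z≢w₁ z≢w₂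
    ... | inj₂ m₂ | inj₁ refl = x₁ , InSplit-at-merged m₂ φx₂ xy₁ xy₃ xy₂ w₁≢w₃ z≢w₁ z≢w₃
    ... | inj₂ m₂ | inj₂ m₃ with Merged-functional m₂ m₃
    ...   | refl = x₂ , InSplit-at-merged (Merged-sym m₂) refl xy₂ xy₃ xy₁ w₂≢w₃ z≢w₂ z≢w₃

  ENPT-preserved : ∀ {u v} → ENPT R u v → EPT R′ u v → ENPT R′ u v
  ENPT-preserved {u} {v} (int , no-split) int′ = int′ , λ _ split′ →
    let _ , c∈P , c∈Q = Intersect⇒common T {paths R u} {paths R v} int
        x , split = InSplit-lift c∈P c∈Q split′
    in no-split x split

module _ {V : Set} {T : Tree} where

  _⊆ᴱ_ : (V → TPath T) → (V → TPath T) → Set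
  p′ ⊆ᴱ p = ∀ u {x y} → PEdge (p′ u) x y → PEdge (p u) x y

  ⊆ᴱ-reflects-EPT : ∀ {p p′} → p′ ⊆ᴱ p → ∀ {u v} → EPT ⟨ T , p′ ⟩ u v → EPT ⟨ T , p ⟩ u v
  ⊆ᴱ-reflects-EPT p′⊆p {u} {v} (x , y , e , e′) = x , y , p′⊆p u e , p′⊆p v e′

  ⊆ᴱ-preserves-ENPT : ∀ {p p′} → p′ ⊆ᴱ p → ∀ {u v} →
    ENPT ⟨ T , p ⟩ u v → EPT ⟨ T , p′ ⟩ u v → ENPT ⟨ T , p′ ⟩ u v
  ⊆ᴱ-preserves-ENPT {p} {p′} p′⊆p {u} {v} (_ , no-split) int′ = int′ ,
    λ z (w₁ , w₂ , w₃ , w₁≢w₂ , w₁≢w₃ , w₂≢w₃ , e₁ , e₂ , e₃) →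
      no-split z (w₁ , w₂ , w₃ , w₁≢w₂ , w₁≢w₃ , w₂≢w₃ , shrink e₁ , shrink e₂ , shrink e₃)
    where
    shrink : ∀ {x y} → UEdge (p′ u) (p′ v) x y → UEdge (p u) (p v) x y
    shrink = Sum.map (p′⊆p u) (p′⊆p v)

  -- Consec is decidable, so the classical case split on u ≟ v₀ (V has no
  -- decidable equality) can be replaced by double-negation stability.
  removeEnd-⊆ᴱ : ∀ {p p′ : V → TPath T} v₀ →
    (verts (p′ v₀) ≡ dropFirst (verts (p v₀)) ⊎ verts (p′ v₀) ≡ dropLast (verts (p v₀))) →
    (∀ v → v ≢ v₀ → verts (p′ v) ≡ verts (p v)) → p′ ⊆ᴱ p
  removeEnd-⊆ᴱ {p} {p′} v₀ end others u = Sum.map Consec-shrinks Consec-shrinks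
    where
    Consec-shrinks : ∀ {x y} → Consec (verts (p′ u)) x y → Consec (verts (p u)) x y
    Consec-shrinks {x} {y} c = Dec.decidable-stable (Consec? (verts (p u)) x y) λ ¬c →
      let transport : ∀ {xs} → verts (p′ u) ≡ xs → Consec xs x y
          transport eq = subst (λ l → Consec l x y) eq c
          u≡v₀ : ¬ u ≢ v₀
          u≡v₀ u≢v₀ = ¬c (transport (others u u≢v₀))
      in u≡v₀ λ { refl → ¬c (Sum.[ Consec-dropFirst _ ∘ transport , Consec-dropLast _ ∘ transport ] end) }

module _ {V : Set} where

  Minify-reflects-EPT : ∀ {R R′ : Rep V} → Minify R R′ → ∀ {u v} → EPT R′ u v → EPT R u v
  Minify-reflects-EPT {R} {R′} (contract (_ , _ , ab , φ , _ , φa≡φb , φ-fibre , _ , paths-φ)) =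
    Contraction.EPT-reflected {R = R} {R′} ab φ φa≡φb φ-fibre paths-φ
  Minify-reflects-EPT {⟨ T , p ⟩} {⟨ .T , p′ ⟩} (removeEnd (refl , v₀ , end , others)) =
    ⊆ᴱ-reflects-EPT {p = p} {p′} (removeEnd-⊆ᴱ {p = p} {p′} v₀ end others)

  Minify-preserves-ENPT : ∀ {R R′ : Rep V} → Minify R R′ → ∀ {u v} →
    ENPT R u v → EPT R′ u v → ENPT R′ u v
  Minify-preserves-ENPT {R} {R′} (contract (_ , _ , ab , φ , _ , φa≡φb , φ-fibre , _ , paths-φ)) =
    Contraction.ENPT-preserved {R = R} {R′} ab φ φa≡φb φ-fibre paths-φ
  Minify-preserves-ENPT {⟨ T , p ⟩} {⟨ .T , p′ ⟩} (removeEnd (refl , v₀ , end , others)) =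
    ⊆ᴱ-preserves-ENPT {p = p} {p′} (removeEnd-⊆ᴱ {p = p} {p′} v₀ end others)

  Minify*-reflects-EPT : ∀ {R R′ : Rep V} → Star Minify R R′ → ∀ {u v} → EPT R′ u v → EPT R u v
  Minify*-reflects-EPT ε        = id
  Minify*-reflects-EPT (s ◅ ss) = Minify-reflects-EPT s ∘ Minify*-reflects-EPT ss

  Minify*-preserves-ENPT : ∀ {R R′ : Rep V} → Star Minify R R′ → ∀ {u v} →
    ENPT R u v → EPT R′ u v → ENPT R′ u v
  Minify*-preserves-ENPT ε        enpt _   = enpt
  Minify*-preserves-ENPT (s ◅ ss) enpt ept =
    Minify*-preserves-ENPT ss (Minify-preserves-ENPT s enpt (Minify*-reflects-EPT ss ept)) ept

  Equivalent-sym : ∀ {R S : Rep V} → Equivalent R S → Equivalent S R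
  Equivalent-sym R≈S u v u≢v = Prod.map ⇔.sym ⇔.sym (R≈S u v u≢v)

  Equivalent-trans : ∀ {R S U : Rep V} → Equivalent R S → Equivalent S U → Equivalent R U
  Equivalent-trans R≈S S≈U u v u≢v =
    Prod.zip ⇔.trans ⇔.trans (R≈S u v u≢v) (S≈U u v u≢v)

  Equivalent-between : ∀ {R S R′ : Rep V} → Star Minify R S → Star Minify S R′ →
    Equivalent R R′ → Equivalent R S
  Equivalent-between {R} {S} {R′} R→S S→R′ R≈R′ u v u≢v =
    mk⇔ EPT-R→S EPT-S→R , mk⇔ ENPT-R→S ENPT-S→R
    where
    open Equivalence
    R≈R′-EPT : EPT R u v ⇔ EPT R′ u v
    R≈R′-EPT = proj₁ (R≈R′ u v u≢v)
    R≈R′-ENPT : ENPT R u v ⇔ ENPT R′ u v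
    R≈R′-ENPT = proj₂ (R≈R′ u v u≢v)
    EPT-S→R : EPT S u v → EPT R u v
    EPT-S→R = Minify*-reflects-EPT R→S
    EPT-R→S : EPT R u v → EPT S u v
    EPT-R→S = Minify*-reflects-EPT S→R′ ∘ to R≈R′-EPT
    ENPT-R→S : ENPT R u v → ENPT S u v
    ENPT-R→S enpt = Minify*-preserves-ENPT R→S enpt (EPT-R→S (proj₁ enpt))
    ENPT-S→R : ENPT S u v → ENPT R u v
    ENPT-S→R enpt = from R≈R′-ENPT
      (Minify*-preserves-ENPT S→R′ enpt (to R≈R′-EPT (EPT-S→R (proj₁ enpt))))

Minify*-along : ∀ {V : Set} {n} (R : ℕ → Rep V) →
  (∀ i → 1 ≤ i → i < n → Star Minify (R i) (R (suc i))) →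
  ∀ {i j} → 1 ≤ i → i ≤′ j → j ≤ n → Star Minify (R i) (R j)
Minify*-along R steps 1≤i (≤′-reflexive refl) _   = ε
Minify*-along R steps 1≤i (≤′-step {j} i≤′j) j<n =
  Minify*-along R steps 1≤i i≤′j (<⇒≤ j<n) ◅◅ steps j (≤-trans 1≤i (≤′⇒≤ i≤′j)) j<n

lemma2 : {V : Set} (n : ℕ) (R : ℕ → Rep V) →
    (∀ i → 1 ≤ i → i < n → Star Minify (R i) (R (suc i))) →
    Equivalent (R 1) (R n) →
    ∀ i j → 1 ≤ i → i ≤ n → 1 ≤ j → j ≤ n → Equivalent (R i) (R j)
lemma2 n R steps R₁≈Rₙ i j 1≤i i≤n 1≤j j≤n =
  Equivalent-trans {R = R i} {R 1} {R j}
    (Equivalent-sym {R = R 1} {R i} (R₁≈ 1≤i i≤n)) (R₁≈ 1≤j j≤n)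
  where
  R₁≈ : ∀ {k} → 1 ≤ k → k ≤ n → Equivalent (R 1) (R k)
  R₁≈ 1≤k k≤n = Equivalent-between
    (Minify*-along R steps ≤-refl (≤⇒≤′ 1≤k) k≤n)
    (Minify*-along R steps 1≤k (≤⇒≤′ k≤n) ≤-refl)
    R₁≈Rₙ
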